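{- Every family of $n$ (not necessarily distinct) odd cycles in the complete graph $K_n$ has a rainbow odd cycle.
   Context: A cycle is regarded as its set of edges. A family means a multiset (repetitions allowed). Given a family $\mathcal{E}$ of edge sets, an $\mathcal{E}$-rainbow set is a set $R\subseteq\bigcup\mathcal{E}$ together with an injection $\sigma:R\to\mathcal{E}$ such that $e\in\sigma(e)$ for all $e\in R$. A rainbow odd cycle is a rainbow set of edges forming a cycle of odd length. -}

module Defs where

open import Data.Nat as ℕ using (ℕ; zero; suc; _*_; _≤_)
open import Data.Fin using (Fin; zero; suc; toℕ; lower₁)
open import Data.Product using (Σ; ∃; _×_; _,_)
open import Data.Sum using (_⊎_)
open import Relation.Nullary using (yes; no)
open import Relation.Binary.PropositionalEquality using (_≡_)
open import Function.Definitions using (Injective)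

Odd : ℕ → Set
Odd k = ∃ λ m → k ≡ suc (2 * m)

cnext : ∀ {m} → Fin (suc m) → Fin (suc m)
cnext {m} i with m ℕ.≟ toℕ i
... | yes _ = zero
... | no ne = suc (lower₁ i ne)

SameEdge : ∀ {n} → Fin n → Fin n → Fin n → Fin n → Set
SameEdge u v x y = (u ≡ x × v ≡ y) ⊎ (u ≡ y × v ≡ x)

-- A cycle in the complete graph K_n on vertex set Fin n:
-- a cyclic sequence of (suc len) ≥ 3 pairwise distinct vertices
-- v₀ , … , v_len ; its edges are {vᵢ , v_{i+1 mod (suc len)}}.
record Cycle (n : ℕ) : Set where
  constructor mkCycle
  field
    len    : ℕ
    long   : 3 ≤ suc len
    vert   : Fin (suc len) → Fin n
    vinj   : Injective _≡_ _≡_ vert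

open Cycle public

size : ∀ {n} → Cycle n → ℕ
size C = suc (len C)

edgeFst : ∀ {n} (C : Cycle n) → Fin (size C) → Fin n
edgeFst C i = vert C i

edgeSnd : ∀ {n} (C : Cycle n) → Fin (size C) → Fin n
edgeSnd C i = vert C (cnext i)

EdgeIn : ∀ {n} → Fin n → Fin n → Cycle n → Set
EdgeIn u v C = ∃ λ (i : Fin (size C)) → SameEdge u v (edgeFst C i) (edgeSnd C i)

OddCycle : ∀ {n} → Cycle n → Set
OddCycle C = Odd (size C)

Family : ℕ → ℕ → Set
Family m n = Fin m → Cycle n

-- F has a rainbow odd cycle: an odd cycle D together with an injection σ
-- from the edges of D (indexed by Fin (size D); distinct indices give
-- distinct edges) into the family, such that each edge e lies in σ(e).
HasRainbowOddCycle : ∀ {m n} → Family m n → Set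
HasRainbowOddCycle {m} {n} F =
  Σ (Cycle n) λ D → OddCycle D ×
    Σ (Fin (size D) → Fin m) λ σ → Injective _≡_ _≡_ σ ×
      (∀ i → EdgeIn (edgeFst D i) (edgeSnd D i) (F (σ i)))

-- Process the colours one at a time, letting colour c label at most one edge of its own
-- cycle F c. Every vertex is joined to a root by a walk along labelled edges, and after j
-- colours at most n − j roots remain. For the next colour c, either some edge of F c joins
-- vertices with different roots (label it, merging two root classes), or some edge joins
-- two vertices with the same root at walk distances of equal parity (closing up gives an
-- odd closed walk of labelled edges), or else distance parity properly 2-colours the odd
-- cycle F c, which is impossible. Each merge removes a root and one always remains, so
-- within n colours the second case occurs. A shortest odd closed subwalk is a cycle, and
-- it is rainbow because each colour labels a single edge and a cycle's edges are distinct.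
module Submission where

open import Defs
open import Data.Nat as ℕ using (ℕ; zero; suc; _+_; _*_; _≤_; _<_; s≤s; z≤n; parity)
open import Data.Nat.Properties
  using (+-comm; +-suc; +-identityʳ; m<m+n; suc-injective; ≤-refl; ≤-trans;
         n≤1+n; <-irrefl; <⇒≤; module ≤-Reasoning; +-monoˡ-≤; ≤-reflexive; m≤n+m)
open import Data.Nat.Induction using (<-wellFounded)
open import Data.Nat.Tactic.RingSolver using (solve-∀)
open import Data.Parity.Base as ℙ using (Parity; 0ℙ; 1ℙ; _⁻¹)
open import Data.Parity.Properties
  using (suc-homo-⁻¹; ⁻¹-involutive; *-homo-*; +-homo-+; p≢p⁻¹; p+p≡0ℙ)
  renaming (_≟_ to _≟ℙ_)
open import Data.Fin as Fin using (Fin; zero; suc; toℕ; lower₁; fromℕ<)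
open import Data.Fin.Properties using (toℕ-lower₁; toℕ<n; toℕ-injective; any?; toℕ-fromℕ<)
open import Data.List as List using (List; filter; allFin)
open import Data.List.Properties using (filter-notAll; length-tabulate)
open import Data.List.Membership.Propositional using (_∈_)
open import Data.List.Membership.Propositional.Properties using (∈-filter⁺; ∈-allFin)
open import Data.List.Relation.Unary.Any as Any using (Any)
open import Data.Maybe using (Maybe; just; nothing)
open import Data.Maybe.Properties using (just-injective)
open import Data.Product using (Σ; ∃; ∃₂; _×_; _,_; proj₁; proj₂)
open import Data.Sum using (_⊎_; inj₁; inj₂; [_,_]′)
open import Data.Empty using (⊥-elim)
open import Data.Vec.Functional using (updateAt)
open import Data.Vec.Functional.Properties using (updateAt-updates; updateAt-minimal)
open import Function using (_∘_; const; id)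
open import Function.Definitions using (Injective)
open import Induction.WellFounded using (Acc; acc)
open import Relation.Binary.Definitions using (DecidableEquality)
open import Relation.Nullary using (¬_; Dec; yes; no; ¬?)
open import Relation.Nullary.Decidable using (decidable-stable)
open import Relation.Binary.PropositionalEquality

parity-suc : ∀ n → parity (suc n) ≡ parity n ⁻¹
parity-suc n = trans (sym (⁻¹-involutive _)) (cong _⁻¹ (suc-homo-⁻¹ n))

Odd⇒parity≡1ℙ : ∀ {k} → Odd k → parity k ≡ 1ℙ
Odd⇒parity≡1ℙ (m , refl) = trans (parity-suc (2 * m)) (cong _⁻¹ (*-homo-* 2 m))

parity≡1ℙ⇒Odd : ∀ k → parity k ≡ 1ℙ → Odd k
parity≡1ℙ⇒Odd (suc zero)    _ = 0 , refl
parity≡1ℙ⇒Odd (suc (suc k)) p with parity≡1ℙ⇒Odd k p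
... | m , refl = suc m , cong (2 +_) (sym (+-suc m (m + 0)))

⁻¹-distribˡ-+ : ∀ p q → p ⁻¹ ℙ.+ q ≡ (p ℙ.+ q) ⁻¹
⁻¹-distribˡ-+ 0ℙ q = refl
⁻¹-distribˡ-+ 1ℙ q = sym (⁻¹-involutive q)

p≢q⇒q≡p⁻¹ : ∀ {p q} → p ≢ q → q ≡ p ⁻¹
p≢q⇒q≡p⁻¹ {0ℙ} {0ℙ} p≢q = ⊥-elim (p≢q refl)
p≢q⇒q≡p⁻¹ {0ℙ} {1ℙ} _   = refl
p≢q⇒q≡p⁻¹ {1ℙ} {0ℙ} _   = refl
p≢q⇒q≡p⁻¹ {1ℙ} {1ℙ} p≢q = ⊥-elim (p≢q refl)

+-odd-split : ∀ p q r → p ℙ.+ q ℙ.+ r ≡ 1ℙ → q ≡ 1ℙ ⊎ r ℙ.+ p ≡ 1ℙ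
+-odd-split _  1ℙ _  _  = inj₁ refl
+-odd-split 0ℙ 0ℙ 1ℙ _  = inj₂ refl
+-odd-split 1ℙ 0ℙ 0ℙ _  = inj₂ refl
+-odd-split 0ℙ 0ℙ 0ℙ ()
+-odd-split 1ℙ 0ℙ 1ℙ ()

parity-odd-split : ∀ a b c → parity (a + b + c) ≡ 1ℙ → parity b ≡ 1ℙ ⊎ parity (c + a) ≡ 1ℙ
parity-odd-split a b c odd
  rewrite +-homo-+ (a + b) c | +-homo-+ a b | +-homo-+ c a = +-odd-split (parity a) (parity b) (parity c) odd

n<m+n+o : ∀ m n o → 1 ≤ m + o → n < m + n + o
n<m+n+o m n o pos = subst (n <_) (rearrange m n o) (m<m+n n pos)
  where
    rearrange : ∀ m n o → n + (m + o) ≡ m + n + o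
    rearrange = solve-∀

o+m<m+n+o : ∀ m n o → 1 ≤ n → o + m < m + n + o
o+m<m+n+o m n o pos = subst (o + m <_) (rearrange m n o) (m<m+n (o + m) pos)
  where
    rearrange : ∀ m n o → o + m + n ≡ m + n + o
    rearrange = solve-∀

-- Cyclic successor on Fin

CyclicStep : ℕ → ℕ → ℕ → Set
CyclicStep m a b = (m ≡ a × b ≡ 0) ⊎ b ≡ suc a

cnext-cyclicStep : ∀ {m} (i : Fin (suc m)) → CyclicStep m (toℕ i) (toℕ (cnext i))
cnext-cyclicStep {m} i with m ℕ.≟ toℕ i
... | yes m≡i = inj₁ (m≡i , refl)
... | no  m≢i = inj₂ (cong suc (toℕ-lower₁ i m≢i))

cyclicStep-irrefl : ∀ {m a} → 1 ≤ m → ¬ CyclicStep m a a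
cyclicStep-irrefl () (inj₁ (refl , refl))
cyclicStep-irrefl _  (inj₂ ())

cyclicStep-asym : ∀ {m a b} → 2 ≤ m → CyclicStep m a b → ¬ CyclicStep m b a
cyclicStep-asym ()       (inj₁ (refl , refl)) (inj₁ (refl , refl))
cyclicStep-asym (s≤s ()) (inj₁ (refl , refl)) (inj₂ refl)
cyclicStep-asym (s≤s ()) (inj₂ refl)          (inj₁ (refl , refl))
cyclicStep-asym _        (inj₂ refl)          (inj₂ ())

cnext≢id : ∀ {m} → 1 ≤ m → (i : Fin (suc m)) → cnext i ≢ i
cnext≢id 1≤m i eq =
  cyclicStep-irrefl 1≤m (subst (CyclicStep _ (toℕ i)) (cong toℕ eq) (cnext-cyclicStep i))

cnext²≢id : ∀ {m} → 2 ≤ m → (i : Fin (suc m)) → cnext (cnext i) ≢ i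
cnext²≢id 2≤m i eq = cyclicStep-asym 2≤m (cnext-cyclicStep i)
  (subst (CyclicStep _ _) (cong toℕ eq) (cnext-cyclicStep (cnext i)))

orbit : ∀ {m} → ℕ → Fin (suc m)
orbit zero    = zero
orbit (suc k) = cnext (orbit k)

toℕ-orbit : ∀ {m} k → k ≤ m → toℕ (orbit {m} k) ≡ k
toℕ-orbit zero    _   = refl
toℕ-orbit {m} (suc k) k<m with toℕ-orbit k (≤-trans (n≤1+n k) k<m) | cnext-cyclicStep (orbit {m} k)
... | ih | inj₁ (m≡k , _) = ⊥-elim (<-irrefl (sym (trans m≡k ih)) k<m)
... | ih | inj₂ step      = trans step (cong suc ih)

orbit-period : ∀ {m} → orbit {m} (suc m) ≡ zero
orbit-period {m} with toℕ-orbit m ≤-refl | cnext-cyclicStep (orbit {m} m)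
... | _  | inj₁ (_ , wrap) = toℕ-injective wrap
... | ih | inj₂ step       = ⊥-elim (<-irrefl (trans step (cong suc ih)) (toℕ<n _))

alternating-orbit : ∀ {m} (f : Fin (suc m) → Parity) → (∀ i → f (cnext i) ≡ f i ⁻¹) →
                    ∀ k → f (orbit k) ≡ parity k ℙ.+ f zero
alternating-orbit f alt zero    = refl
alternating-orbit f alt (suc k) = begin
  f (cnext (orbit k))        ≡⟨ alt (orbit k) ⟩
  f (orbit k) ⁻¹             ≡⟨ cong _⁻¹ (alternating-orbit f alt k) ⟩
  (parity k ℙ.+ f zero) ⁻¹   ≡⟨ sym (⁻¹-distribˡ-+ (parity k) (f zero)) ⟩
  parity k ⁻¹ ℙ.+ f zero     ≡⟨ cong (ℙ._+ f zero) (sym (parity-suc k)) ⟩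
  parity (suc k) ℙ.+ f zero  ∎
  where open ≡-Reasoning

odd-not-alternating : ∀ {m} (f : Fin (suc m) → Parity) → parity (suc m) ≡ 1ℙ →
                      ¬ (∀ i → f (cnext i) ≡ f i ⁻¹)
odd-not-alternating {m} f odd alt = p≢p⁻¹ (f zero) (begin
  f zero                     ≡⟨ cong f (sym orbit-period) ⟩
  f (orbit (suc m))          ≡⟨ alternating-orbit f alt (suc m) ⟩
  parity (suc m) ℙ.+ f zero  ≡⟨ cong (ℙ._+ f zero) odd ⟩
  f zero ⁻¹                  ∎)
  where open ≡-Reasoning

module _ {n : ℕ} where

  SameEdge-swap : {u v x y : Fin n} → SameEdge u v x y → SameEdge v u x y
  SameEdge-swap (inj₁ (p , q)) = inj₂ (q , p)
  SameEdge-swap (inj₂ (p , q)) = inj₁ (q , p)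

  SameEdge-sym : {u v x y : Fin n} → SameEdge u v x y → SameEdge x y u v
  SameEdge-sym (inj₁ (refl , refl)) = inj₁ (refl , refl)
  SameEdge-sym (inj₂ (refl , refl)) = inj₂ (refl , refl)

  SameEdge-trans : {u v a b x y : Fin n} → SameEdge u v a b → SameEdge a b x y → SameEdge u v x y
  SameEdge-trans (inj₁ (refl , refl)) e                    = e
  SameEdge-trans (inj₂ (refl , refl)) (inj₁ (refl , refl)) = inj₂ (refl , refl)
  SameEdge-trans (inj₂ (refl , refl)) (inj₂ (refl , refl)) = inj₁ (refl , refl)

  EdgeIn-irrefl : ∀ {u} (C : Cycle n) → ¬ EdgeIn u u C
  EdgeIn-irrefl C (i , e) = cnext≢id (≤-trans (s≤s z≤n) (ℕ.s≤s⁻¹ (long C))) i (vinj C (loop e))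
    where
      loop : ∀ {u x y} → SameEdge u u x y → y ≡ x
      loop (inj₁ (refl , refl)) = refl
      loop (inj₂ (refl , refl)) = refl

  edge-injective : (C : Cycle n) {i j : Fin (size C)} →
                   SameEdge (edgeFst C i) (edgeSnd C i) (edgeFst C j) (edgeSnd C j) → i ≡ j
  edge-injective C (inj₁ (p , _)) = vinj C p
  edge-injective C {i} {j} (inj₂ (p , q)) = ⊥-elim (cnext²≢id (ℕ.s≤s⁻¹ (long C)) j
    (trans (cong cnext (sym (vinj C p))) (vinj C q)))

-- Walks in an edge-coloured graph

infixr 5 _∷_

data Walk {K V : Set} (R : K → V → V → Set) : V → V → Set where
  []  : ∀ {x} → Walk R x x
  _∷_ : ∀ {c x y z} → R c x y → Walk R y z → Walk R x z

module _ {K V : Set} {R : K → V → V → Set} where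

  length : ∀ {x y} → Walk R x y → ℕ
  length []      = 0
  length (_ ∷ w) = suc (length w)

  infixr 5 _++_

  _++_ : ∀ {x y z} → Walk R x y → Walk R y z → Walk R x z
  []      ++ w' = w'
  (s ∷ w) ++ w' = s ∷ (w ++ w')

  length-++ : ∀ {x y z} (w : Walk R x y) (w' : Walk R y z) → length (w ++ w') ≡ length w + length w'
  length-++ []      w' = refl
  length-++ (s ∷ w) w' = cong suc (length-++ w w')

  reverse : (swap : ∀ {c x y} → R c x y → R c y x) → ∀ {x y} → Walk R x y → Walk R y x
  reverse swap []      = []
  reverse swap (s ∷ w) = reverse swap w ++ (swap s ∷ [])

  length-reverse : (swap : ∀ {c x y} → R c x y → R c y x) {x y : V} (w : Walk R x y) →
                   length (reverse swap w) ≡ length w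
  length-reverse swap []      = refl
  length-reverse swap (s ∷ w) = begin
    length (reverse swap w ++ (swap s ∷ []))  ≡⟨ length-++ (reverse swap w) _ ⟩
    length (reverse swap w) + 1              ≡⟨ +-comm _ 1 ⟩
    suc (length (reverse swap w))            ≡⟨ cong suc (length-reverse swap w) ⟩
    suc (length w)                          ∎
    where open ≡-Reasoning

  source : ∀ {x y} (w : Walk R x y) → Fin (length w) → V
  source (_∷_ {x = x} _ _) zero    = x
  source (_ ∷ w)           (suc i) = source w i

  target : ∀ {x y} (w : Walk R x y) → Fin (length w) → V
  target (_∷_ {y = y} _ _) zero    = y
  target (_ ∷ w)           (suc i) = target w i

  colour : ∀ {x y} (w : Walk R x y) → Fin (length w) → K
  colour (_∷_ {c = c} _ _) zero    = c
  colour (_ ∷ w)           (suc i) = colour w i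

  step-at : ∀ {x y} (w : Walk R x y) (i : Fin (length w)) → R (colour w i) (source w i) (target w i)
  step-at (s ∷ w) zero    = s
  step-at (s ∷ w) (suc i) = step-at w i

  target-last : ∀ {x y} (w : Walk R x y) (i : Fin (length w)) → suc (toℕ i) ≡ length w → target w i ≡ y
  target-last (s ∷ [])    zero    _  = refl
  target-last (s ∷ _ ∷ _) zero    ()
  target-last (s ∷ w)     (suc i) eq = target-last w i (suc-injective eq)

  target-inner : ∀ {c x y z} (s : R c x y) (w : Walk R y z) (i : Fin (suc (length w)))
                 (i≢last : length w ≢ toℕ i) → target (s ∷ w) i ≡ source w (lower₁ i i≢last)
  target-inner s []      zero    i≢last = ⊥-elim (i≢last refl)
  target-inner s (_ ∷ w) zero    _      = refl
  target-inner s (t ∷ w) (suc i) i≢last = target-inner t w i (i≢last ∘ cong suc)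

  target≡source-cnext : ∀ {c x y} (s : R c x y) (w : Walk R y x) (i : Fin (suc (length w))) →
                        target (s ∷ w) i ≡ source (s ∷ w) (cnext i)
  target≡source-cnext s w i with length w ℕ.≟ toℕ i
  ... | yes last = target-last (s ∷ w) i (cong suc (sym last))
  ... | no  inner = target-inner s w i inner

  odd-closed-walk : (swap : ∀ {c x y} → R c x y → R c y x) {c : K} {u v r r' : V} → R c u v →
                    (p : Walk R u r) (q : Walk R v r') → r ≡ r' → parity (length p) ≡ parity (length q) →
                    Σ (Walk R u u) λ w → parity (length w) ≡ 1ℙ
  odd-closed-walk swap s p q refl p≡q = s ∷ (q ++ reverse swap p) , (begin
    parity (suc (length (q ++ reverse swap p)))    ≡⟨ cong (parity ∘ suc) length-q++p⁻¹ ⟩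
    parity (suc (length q + length p))            ≡⟨ parity-suc (length q + length p) ⟩
    parity (length q + length p) ⁻¹               ≡⟨ cong _⁻¹ (+-homo-+ (length q) (length p)) ⟩
    (parity (length q) ℙ.+ parity (length p)) ⁻¹  ≡⟨ cong (λ t → (t ℙ.+ parity (length p)) ⁻¹) (sym p≡q) ⟩
    (parity (length p) ℙ.+ parity (length p)) ⁻¹  ≡⟨ cong _⁻¹ (p+p≡0ℙ (parity (length p))) ⟩
    1ℙ                                            ∎)
    where
      open ≡-Reasoning
      length-q++p⁻¹ : length (q ++ reverse swap p) ≡ length q + length p
      length-q++p⁻¹ = trans (length-++ q (reverse swap p)) (cong (length q +_) (length-reverse swap p))

  splitAt : ∀ {x y} (w : Walk R x y) (i : Fin (length w)) →
            Σ (Walk R x (source w i)) λ p → Σ (Walk R (source w i) y) λ q →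
              length p + length q ≡ length w × 1 ≤ length q
  splitAt (s ∷ w) zero    = [] , s ∷ w , refl , s≤s z≤n
  splitAt (s ∷ w) (suc i) with splitAt w i
  ... | p , q , p+q≡w , q≢[] = s ∷ p , q , cong suc p+q≡w , q≢[]

  record Revisit {x y : V} (w : Walk R x y) : Set where
    field
      {pivot}       : V
      prefix        : Walk R x pivot
      loop          : Walk R pivot pivot
      suffix        : Walk R pivot y
      loop-nonempty : 1 ≤ length loop
      rest-nonempty : 1 ≤ length prefix + length suffix
      length-split  : length prefix + length loop + length suffix ≡ length w

  revisit-∷ : ∀ {c x y z} (s : R c x y) {w : Walk R y z} → Revisit w → Revisit (s ∷ w)
  revisit-∷ s r = record
    { prefix        = s ∷ prefix
    ; loop          = loop
    ; suffix        = suffix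
    ; loop-nonempty = loop-nonempty
    ; rest-nonempty = s≤s z≤n
    ; length-split  = cong suc length-split
    }
    where open Revisit r

  revisit-start : ∀ {c x y z v} (s : R c x y) (w : Walk R y z) (p : Walk R y v) (q : Walk R v z) →
                  v ≡ x → length p + length q ≡ length w → 1 ≤ length q → Revisit (s ∷ w)
  revisit-start s w p q refl p+q≡w q≢[] = record
    { prefix        = []
    ; loop          = s ∷ p
    ; suffix        = q
    ; loop-nonempty = s≤s z≤n
    ; rest-nonempty = q≢[]
    ; length-split  = cong suc p+q≡w
    }

  revisit-or-injective : DecidableEquality V → ∀ {x y} (w : Walk R x y) →
                         Revisit w ⊎ Injective _≡_ _≡_ (source w)
  revisit-or-injective _≟_ [] = inj₂ λ { {()} }
  revisit-or-injective _≟_ (_∷_ {x = x} s w) with revisit-or-injective _≟_ w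
  ... | inj₁ r = inj₁ (revisit-∷ s r)
  ... | inj₂ w-injective with any? (λ i → source w i ≟ x)
  ...   | yes (i , returns) = let p , q , p+q≡w , q≢[] = splitAt w i in
                              inj₁ (revisit-start s w p q returns p+q≡w q≢[])
  ...   | no never-returns = inj₂ injective
    where
      injective : Injective _≡_ _≡_ (source (s ∷ w))
      injective {zero}  {zero}  _  = refl
      injective {zero}  {suc j} eq = ⊥-elim (never-returns (j , sym eq))
      injective {suc i} {zero}  eq = ⊥-elim (never-returns (i , eq))
      injective {suc i} {suc j} eq = cong suc (w-injective eq)

  module _ {x : V} {w : Walk R x x} (r : Revisit w) where
    open Revisit r

    bypass : Walk R pivot pivot
    bypass = suffix ++ prefix

    loop-shorter : length loop < length w
    loop-shorter = subst (length loop <_) length-split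
                         (n<m+n+o (length prefix) (length loop) (length suffix) rest-nonempty)

    bypass-shorter : length bypass < length w
    bypass-shorter = subst₂ _<_ (sym (length-++ suffix prefix)) length-split
                       (o+m<m+n+o (length prefix) (length loop) (length suffix) loop-nonempty)

    odd-loop-or-bypass : parity (length w) ≡ 1ℙ →
                         parity (length loop) ≡ 1ℙ ⊎ parity (length bypass) ≡ 1ℙ
    odd-loop-or-bypass odd with parity-odd-split (length prefix) (length loop) (length suffix)
                                  (trans (cong parity length-split) odd)
    ... | inj₁ loop-odd   = inj₁ loop-odd
    ... | inj₂ bypass-odd = inj₂ (trans (cong parity (length-++ suffix prefix)) bypass-odd)

  record SimpleOddClosedWalk : Set where
    field
      {base} : V
      walk   : Walk R base base
      odd    : parity (length walk) ≡ 1ℙ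
      simple : Injective _≡_ _≡_ (source walk)

  odd-closed-walk⇒simple : DecidableEquality V → ∀ {x} (w : Walk R x x) → parity (length w) ≡ 1ℙ →
                           SimpleOddClosedWalk
  odd-closed-walk⇒simple _≟_ w odd = go w odd (<-wellFounded _)
    where
      go : ∀ {x} (w : Walk R x x) → parity (length w) ≡ 1ℙ → Acc _<_ (length w) → SimpleOddClosedWalk
      go w odd (acc shorter) with revisit-or-injective _≟_ w
      ... | inj₂ simple = record { walk = w ; odd = odd ; simple = simple }
      ... | inj₁ r with odd-loop-or-bypass r odd
      ...   | inj₁ loop-odd   = go (Revisit.loop r) loop-odd (shorter (loop-shorter r))
      ...   | inj₂ bypass-odd = go (bypass r) bypass-odd (shorter (bypass-shorter r))

module _ {K V : Set} {R R' : K → V → V → Set} (f : ∀ {c x y} → R c x y → R' c x y) where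

  map : ∀ {x y} → Walk R x y → Walk R' x y
  map []      = []
  map (s ∷ w) = f s ∷ map w

  length-map : ∀ {x y} (w : Walk R x y) → length (map w) ≡ length w
  length-map []      = refl
  length-map (s ∷ w) = cong suc (length-map w)

-- Labelling colours by edges

Labelling : ℕ → ℕ → Set
Labelling k n = Fin k → Maybe (Fin n × Fin n)

module _ {k n : ℕ} where

  Step : Labelling k n → Fin k → Fin n → Fin n → Set
  Step E c x y = ∃₂ λ a b → E c ≡ just (a , b) × SameEdge x y a b

  Step-sym : ∀ {E c x y} → Step E c x y → Step E c y x
  Step-sym (a , b , E≡ab , xy~ab) = a , b , E≡ab , SameEdge-swap xy~ab

  Step-functional : ∀ {E c x y u v} → Step E c x y → Step E c u v → SameEdge x y u v
  Step-functional (a , b , E≡ab , xy~ab) (a' , b' , E≡a'b' , uv~a'b')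
    with just-injective (trans (sym E≡ab) E≡a'b')
  ... | refl = SameEdge-trans xy~ab (SameEdge-sym uv~a'b')

  _⊑_ : Labelling k n → Labelling k n → Set
  E ⊑ E' = ∀ c {e} → E c ≡ just e → E' c ≡ just e

  Step-mono : ∀ {E E'} → E ⊑ E' → ∀ {c x y} → Step E c x y → Step E' c x y
  Step-mono E⊑E' {c} (a , b , E≡ab , xy~ab) = a , b , E⊑E' c E≡ab , xy~ab

  addLabel : Labelling k n → Fin k → Fin n → Fin n → Labelling k n
  addLabel E c u v = updateAt E c (const (just (u , v)))

  addLabel-step : ∀ E c u v → Step (addLabel E c u v) c u v
  addLabel-step E c u v = u , v , updateAt-updates c E , inj₁ (refl , refl)

  addLabel-other : ∀ E {c c'} u v → c' ≢ c → addLabel E c u v c' ≡ E c'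
  addLabel-other E {c} {c'} u v c'≢c = updateAt-minimal c' c E c'≢c

  addLabel-extends : ∀ {E c} u v → E c ≡ nothing → E ⊑ addLabel E c u v
  addLabel-extends {E} u v unlabelled c' E≡e =
    trans (addLabel-other E u v λ { refl → nothing≢just (trans (sym unlabelled) E≡e) }) E≡e
    where
      nothing≢just : ∀ {A : Set} {a : A} → nothing ≢ just a
      nothing≢just ()

module _ {k n : ℕ} (F : Family k n) where

  Sound : Labelling k n → Set
  Sound E = ∀ c {a b} → E c ≡ just (a , b) → EdgeIn a b (F c)

  addLabel-sound : ∀ {E c u v} → Sound E → EdgeIn u v (F c) → Sound (addLabel E c u v)
  addLabel-sound {E} {c} {u} {v} sound uv∈F c' E'≡ab with c' Fin.≟ c
  ... | yes refl with just-injective (trans (sym (updateAt-updates c E)) E'≡ab)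
  ...   | refl = uv∈F
  addLabel-sound {E} {c} {u} {v} sound uv∈F c' E'≡ab | no c'≢c =
    sound c' (trans (sym (addLabel-other E u v c'≢c)) E'≡ab)

  Step-edgeIn : ∀ {E c x y} → Sound E → Step E c x y → EdgeIn x y (F c)
  Step-edgeIn sound (a , b , E≡ab , xy~ab) with sound _ E≡ab
  ... | i , ab~edge = i , SameEdge-trans xy~ab ab~edge

  Step-irrefl : ∀ {E c x} → Sound E → ¬ Step E c x x
  Step-irrefl {c = c} sound s = EdgeIn-irrefl (F c) (Step-edgeIn sound s)

  simple-odd-closed-walk⇒rainbow : ∀ {E x} → Sound E → (w : Walk (Step E) x x) →
    parity (length w) ≡ 1ℙ → Injective _≡_ _≡_ (source w) → HasRainbowOddCycle F
  simple-odd-closed-walk⇒rainbow sound []           () _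
  simple-odd-closed-walk⇒rainbow sound (s ∷ [])     _  _ = ⊥-elim (Step-irrefl sound s)
  simple-odd-closed-walk⇒rainbow sound (_ ∷ _ ∷ []) () _
  simple-odd-closed-walk⇒rainbow {E} sound w@(s ∷ w'@(_ ∷ _ ∷ _)) odd simple =
    D , parity≡1ℙ⇒Odd (length w) odd , colour w , colour-injective , λ i → Step-edgeIn {E} sound (edge-step i)
    where
      D : Cycle n
      D = mkCycle (length w') (s≤s (s≤s (s≤s z≤n))) (source w) simple

      edge-step : ∀ i → Step E (colour w i) (edgeFst D i) (edgeSnd D i)
      edge-step i = subst (Step E _ _) (target≡source-cnext s w' i) (step-at w i)

      colour-injective : Injective _≡_ _≡_ (colour w)
      colour-injective {i} {j} eq = edge-injective D
        (Step-functional {E = E} (edge-step i) (subst (λ c → Step E c _ _) (sym eq) (edge-step j)))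

-- Growing a rainbow forest

∈⇒nonempty : ∀ {A : Set} {x : A} {xs : List A} → x ∈ xs → 1 ≤ List.length xs
∈⇒nonempty (Any.here _)  = s≤s z≤n
∈⇒nonempty (Any.there _) = s≤s z≤n

module _ {k n : ℕ} (F : Family k n) (F-odd : ∀ c → OddCycle (F c)) where

  record Forest (j : ℕ) : Set where
    field
      label     : Labelling k n
      sound     : Sound F label
      unused    : ∀ c → j ≤ toℕ c → label c ≡ nothing
      roots     : List (Fin n)
      toRoot    : ∀ x → ∃ λ r → Walk (Step label) x r × r ∈ roots
      few-roots : List.length roots + j ≤ n

  trivial-forest : Forest 0
  trivial-forest = record
    { label     = const nothing
    ; sound     = λ _ ()
    ; unused    = λ _ _ → refl
    ; roots     = allFin n
    ; toRoot    = λ x → x , [] , ∈-allFin x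
    ; few-roots = ≤-reflexive (trans (+-identityʳ _) (length-tabulate id))
    }

  module Grow {j : ℕ} (T : Forest j) (c : Fin k) (c≡j : toℕ c ≡ j) where
    open Forest T

    root : Fin n → Fin n
    root x = proj₁ (toRoot x)

    path : ∀ x → Walk (Step label) x (root x)
    path x = proj₁ (proj₂ (toRoot x))

    root∈roots : ∀ x → root x ∈ roots
    root∈roots x = proj₂ (proj₂ (toRoot x))

    depth : Fin n → Parity
    depth x = parity (length (path x))

    u v : Fin (size (F c)) → Fin n
    u = edgeFst (F c)
    v = edgeSnd (F c)

    extended : Fin (size (F c)) → Labelling k n
    extended i = addLabel label c (u i) (v i)

    extended-sound : ∀ i → Sound F (extended i)
    extended-sound i = addLabel-sound F sound (i , inj₁ (refl , refl))

    label⊑extended : ∀ i → label ⊑ extended i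
    label⊑extended i = addLabel-extends (u i) (v i) (unused c (≤-reflexive (sym c≡j)))

    path⁺ : ∀ i x → Walk (Step (extended i)) x (root x)
    path⁺ i x = map (Step-mono (label⊑extended i)) (path x)

    length-path⁺ : ∀ i x → length (path⁺ i x) ≡ length (path x)
    length-path⁺ i x = length-map (Step-mono (label⊑extended i)) (path x)

    close : ∀ i → root (u i) ≡ root (v i) → depth (u i) ≡ depth (v i) → HasRainbowOddCycle F
    close i same-root same-depth = simple-odd-closed-walk⇒rainbow F (extended-sound i) walk odd simple
      where
        odd-walk : Σ (Walk (Step (extended i)) (u i) (u i)) λ w → parity (length w) ≡ 1ℙ
        odd-walk = odd-closed-walk (Step-sym {E = extended i}) (addLabel-step label c (u i) (v i))
                     (path⁺ i (u i)) (path⁺ i (v i)) same-root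
                     (trans (cong parity (length-path⁺ i (u i)))
                       (trans same-depth (cong parity (sym (length-path⁺ i (v i))))))
        open SimpleOddClosedWalk (odd-closed-walk⇒simple Fin._≟_ (proj₁ odd-walk) (proj₂ odd-walk))

    extended-unused : ∀ i c' → suc j ≤ toℕ c' → extended i c' ≡ nothing
    extended-unused i c' j<c' = trans (addLabel-other label (u i) (v i) c'≢c) (unused c' (<⇒≤ j<c'))
      where
        c'≢c : c' ≢ c
        c'≢c refl = <-irrefl (sym c≡j) j<c'

    module _ (i : Fin (size (F c))) (ru≢rv : root (u i) ≢ root (v i)) where

      ≢rv? : ∀ r → Dec (r ≢ root (v i))
      ≢rv? r = ¬? (r Fin.≟ root (v i))

      merged-roots : List (Fin n)
      merged-roots = filter ≢rv? roots

      toMergedRoot : ∀ x → ∃ λ r → Walk (Step (extended i)) x r × r ∈ merged-roots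
      toMergedRoot x with root x Fin.≟ root (v i)
      ... | yes rx≡rv = root (u i)
                      , subst (Walk _ x) rx≡rv (path⁺ i x)
                        ++ reverse (Step-sym {E = extended i}) (path⁺ i (v i))
                        ++ Step-sym {E = extended i} (addLabel-step label c (u i) (v i))
                        ∷ path⁺ i (u i)
                      , ∈-filter⁺ ≢rv? (root∈roots (u i)) ru≢rv
      ... | no rx≢rv = root x , path⁺ i x , ∈-filter⁺ ≢rv? (root∈roots x) rx≢rv

      fewer-roots : List.length merged-roots + suc j ≤ n
      fewer-roots = begin
        List.length merged-roots + suc j    ≡⟨ +-suc _ j ⟩
        suc (List.length merged-roots) + j  ≤⟨ +-monoˡ-≤ j (filter-notAll ≢rv? roots rv∈roots) ⟩
        List.length roots + j               ≤⟨ few-roots ⟩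
        n                                   ∎
        where
          open ≤-Reasoning
          rv∈roots : Any (λ r → ¬ (r ≢ root (v i))) roots
          rv∈roots = Any.map (λ rv≡r r≢rv → r≢rv (sym rv≡r)) (root∈roots (v i))

      merge : Forest (suc j)
      merge = record
        { label     = extended i
        ; sound     = extended-sound i
        ; unused    = extended-unused i
        ; roots     = merged-roots
        ; toRoot    = toMergedRoot
        ; few-roots = fewer-roots
        }

    no-crossing⇒same-root : ¬ (∃ λ i → root (u i) ≢ root (v i)) → ∀ i → root (u i) ≡ root (v i)
    no-crossing⇒same-root no-crossing i =
      decidable-stable (root (u i) Fin.≟ root (v i)) (λ ne → no-crossing (i , ne))

    grow : HasRainbowOddCycle F ⊎ Forest (suc j)
    grow with any? (λ i → ¬? (root (u i) Fin.≟ root (v i)))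
    ... | yes (i , crossing) = inj₂ (merge i crossing)
    ... | no no-crossing with any? (λ i → depth (u i) ≟ℙ depth (v i))
    ...   | yes (i , same-depth) = inj₁ (close i (no-crossing⇒same-root no-crossing i) same-depth)
    ...   | no alternating = ⊥-elim (odd-not-alternating (depth ∘ vert (F c))
                                       (Odd⇒parity≡1ℙ (F-odd c))
                                       (λ i → p≢q⇒q≡p⁻¹ (λ eq → alternating (i , eq))))

  module _ (n≤k : n ≤ k) (x₀ : Fin n) where

    grow-from : ∀ r j → r + j ≡ n → Forest j → HasRainbowOddCycle F
    grow-from zero j j≡n T = ⊥-elim (<-irrefl j≡n (≤-trans (+-monoˡ-≤ j nonempty) (Forest.few-roots T)))
      where nonempty = ∈⇒nonempty (proj₂ (proj₂ (Forest.toRoot T x₀)))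
    grow-from (suc r) j r+j≡n T =
      [ id , grow-from r (suc j) (trans (+-suc r j) r+j≡n) ]′ (Grow.grow T (fromℕ< j<k) (toℕ-fromℕ< j<k))
      where
        j<k : j < k
        j<k = ≤-trans (subst (j <_) r+j≡n (s≤s (m≤n+m j r))) n≤k

rainbow-odd-cycle : ∀ {k n} → 1 ≤ n → n ≤ k → (F : Family k n) → (∀ c → OddCycle (F c)) →
                    HasRainbowOddCycle F
rainbow-odd-cycle {n = n} 1≤n n≤k F F-odd =
  grow-from F F-odd n≤k (fromℕ< 1≤n) n 0 (+-identityʳ n) (trivial-forest F F-odd)

proposition2p1 : ∀ (n : ℕ) → 3 ≤ n → (F : Family n n) →
    (∀ i → OddCycle (F i)) → HasRainbowOddCycle F
proposition2p1 n 3≤n = rainbow-odd-cycle (≤-trans (s≤s z≤n) 3≤n) ≤-refl
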